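{- Let $\mathcal{C}$ be a class of matroids closed under restriction and let $\mathbf{BigM}$ be a finite matroid. Let $(f_{\mathbf{M},\pi})$ be an online matroid morphism of $\mathcal{C}$ into $\mathbf{BigM}$ such that for every $\mathbf{M}\in\mathcal{C}$ and any two orderings $\pi,\pi'$ of the ground set of $\mathbf{M}$, there is an automorphism $A\in\mathrm{Aut}(\mathbf{BigM})$ with $f_{\mathbf{M},\pi'}=A\circ f_{\mathbf{M},\pi}$. Then there is an order-independent randomized online matroid morphism of $\mathcal{C}$ into $\mathbf{BigM}$.
   Context: Matroids have finite ground sets, denoted by the same letter as the matroid. A morphism $f:\mathbf{M}\to\mathbf{N}$ is a map of ground sets with $\mathrm{rank}_{\mathbf{N}}(f(S))=\mathrm{rank}_{\mathbf{M}}(S)$ for all $S$; an automorphism is a bijective morphism from a matroid to itself, and $\mathrm{Aut}(\mathbf{M})$ is the group of automorphisms. An ordering of $\mathbf{M}$ with $|\mathbf{M}|=m$ is a bijection $\pi:[m]\to\mathbf{M}$; for $m'<m$, the prefix-restriction $(\mathbf{M}',\pi')$ of $(\mathbf{M},\pi)$ is the restriction of $\mathbf{M}$ to $\pi([m'])$ with $\pi'=\pi|_{[m']}$. An online matroid morphism (OMM) of $\mathcal{C}$ into $\mathbf{BigM}$ is a family of morphisms $f_{\mathbf{M},\pi}:\mathbf{M}\to\mathbf{BigM}$ for all $\mathbf{M}\in\mathcal{C}$ and orderings $\pi$, such that for every prefix-restriction $(\mathbf{M}',\pi')$ of $(\mathbf{M},\pi)$, $f_{\mathbf{M}',\pi'}$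 is the restriction of $f_{\mathbf{M},\pi}$. A randomized OMM assigns to each $(\mathbf{M},\pi)$ a distribution over morphisms $f_{\mathbf{M},\pi}:\mathbf{M}\to\mathbf{BigM}$ such that the restriction of $f_{\mathbf{M},\pi}$ to any prefix-restriction $(\mathbf{M}',\pi')$ is distributed as $f_{\mathbf{M}',\pi'}$; it is order-independent if the distribution of $f_{\mathbf{M},\pi}$ does not depend on $\pi$. -}

module Defs where

open import Data.Bool using (Bool; true; false; T; _∧_)
open import Data.Unit using (tt)
open import Data.Nat using (ℕ; _≤_; _<_; _+_)
open import Data.Rational using (ℚ; 0ℚ; 1ℚ) renaming (_+_ to _+ℚ_; _≤_ to _≤ℚ_)
open import Data.List using (List; []; _∷_; map; filter; take; length; _++_; foldr)
open import Data.Bool.ListAction using (and)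
open import Relation.Nullary.Decidable using (T?)
open import Data.List.Membership.Propositional using (_∈_; mapWith∈)
open import Data.List.Membership.DecPropositional as DecMem using ()
open import Data.List.Relation.Unary.Unique.Propositional using (Unique)
open import Data.List.Relation.Unary.All using (All)
open import Data.Product using (Σ; _×_; _,_; proj₁; proj₂; ∃)
open import Function using (_∘_)
open import Function.Definitions using (Injective; Surjective)
open import Relation.Binary.Definitions using (DecidableEquality)
open import Relation.Binary.PropositionalEquality using (_≡_; refl; cong)
open import Relation.Nullary using (yes; no; ⌊_⌋)
open import Relation.Nullary.Decidable using (fromWitness)

-- Finite subsets of E are
-- represented by lists (order / multiplicity irrelevant; invariance
-- under equal underlying sets follows from monotonicity below).

record Matroid : Set₁ where
  field
    E    : Set
    _≟_  : DecidableEquality E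
    rank : List E → ℕ

open Matroid public

_⊆ₗ_ : {A : Set} → List A → List A → Set
X ⊆ₗ Y = ∀ {x} → x ∈ X → x ∈ Y

inter : (M : Matroid) → List (E M) → List (E M) → List (E M)
inter M X Y = filter (λ x → DecMem._∈?_ (_≟_ M) x Y) X

record IsMatroid (M : Matroid) : Set where
  field
    finite    : Σ (List (E M)) (λ xs → ∀ x → x ∈ xs)
    rank-card : ∀ X → rank M X ≤ length X
    rank-mono : ∀ X Y → X ⊆ₗ Y → rank M X ≤ rank M Y
    rank-sub  : ∀ X Y → rank M (X ++ Y) + rank M (inter M X Y) ≤ rank M X + rank M Y

IsMorphism : (M N : Matroid) → (E M → E N) → Set
IsMorphism M N f = ∀ (S : List (E M)) → rank N (map f S) ≡ rank M S

IsAutomorphism : (M : Matroid) → (E M → E M) → Set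
IsAutomorphism M A = IsMorphism M M A × Injective _≡_ _≡_ A × Surjective _≡_ _≡_ A

T-irr : ∀ {b} (p q : T b) → p ≡ q
T-irr {true} tt tt = refl

Σ-T-≟ : {A : Set} (P : A → Bool) → DecidableEquality A → DecidableEquality (Σ A (λ x → T (P x)))
Σ-T-≟ P _≟A_ (x , p) (y , q) with x ≟A y
... | yes refl = yes (cong (x ,_) (T-irr p q))
... | no x≢y   = no (λ eq → x≢y (cong proj₁ eq))

restrict : (M : Matroid) → (S : E M → Bool) → Matroid
restrict M S = record
  { E    = Σ (E M) (λ x → T (S x))
  ; _≟_  = Σ-T-≟ S (_≟_ M)
  ; rank = λ X → rank M (map proj₁ X)
  }

-- Orderings: a bijection [m] → M is the list π(1), …, π(m) of all
-- elements of M without repetition.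

IsOrdering : (M : Matroid) → List (E M) → Set
IsOrdering M xs = Unique xs × (∀ x → x ∈ xs)

prefixSet : (M : Matroid) → List (E M) → ℕ → E M → Bool
prefixSet M xs m' x = ⌊ DecMem._∈?_ (_≟_ M) x (take m' xs) ⌋

prefixMatroid : (M : Matroid) → List (E M) → ℕ → Matroid
prefixMatroid M xs m' = restrict M (prefixSet M xs m')

prefixOrdering : (M : Matroid) (xs : List (E M)) (m' : ℕ) → List (E (prefixMatroid M xs m'))
prefixOrdering M xs m' = mapWith∈ (take m' xs) (λ {x} x∈ → x , fromWitness x∈)

-- Online matroid morphisms.
-- A family assigns a map to every matroid and list; the requirements
-- only concern matroids of the class and genuine orderings.

Family : Matroid → Set₁
Family B = (M : Matroid) → List (E M) → E M → E B

IsOMM : (C : Matroid → Set) (B : Matroid) → Family B → Set₁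
IsOMM C B f =
  (∀ M π → C M → IsOrdering M π → IsMorphism M B (f M π))
  × (∀ M π m' → C M → IsOrdering M π → m' < length π →
       ∀ (y : E (prefixMatroid M π m')) →
         f (prefixMatroid M π m') (prefixOrdering M π m') y ≡ f M π (proj₁ y))

Dist : Matroid → Matroid → Set
Dist M B = List (ℚ × (E M → E B))

sumℚ : List ℚ → ℚ
sumℚ = foldr _+ℚ_ 0ℚ

IsMorphDist : (M B : Matroid) → Dist M B → Set
IsMorphDist M B D =
  All (λ wh → 0ℚ ≤ℚ proj₁ wh) D
  × sumℚ (map proj₁ D) ≡ 1ℚ
  × All (λ wh → IsMorphism M B (proj₂ wh)) D

agreeOn : (M B : Matroid) → List (E M) → (E M → E B) → (E M → E B) → Bool
agreeOn M B xs h g = and (map (λ x → ⌊ _≟_ B (h x) (g x) ⌋) xs)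

-- probability that the random map equals g (maps compared on the
-- enumeration xs of the ground set)
mass : (M B : Matroid) → List (E M) → (E M → E B) → Dist M B → ℚ
mass M B xs g D = sumℚ (map proj₁ (filter (λ wh → T? (agreeOn M B xs (proj₂ wh) g)) D))

SameDist : (M B : Matroid) → List (E M) → Dist M B → Dist M B → Set
SameDist M B xs D₁ D₂ = ∀ (g : E M → E B) → mass M B xs g D₁ ≡ mass M B xs g D₂

restrictDist : (M B : Matroid) (π : List (E M)) (m' : ℕ) → Dist M B → Dist (prefixMatroid M π m') B
restrictDist M B π m' = map (λ wh → proj₁ wh , (proj₂ wh ∘ proj₁))

RandFamily : Matroid → Set₁
RandFamily B = (M : Matroid) → List (E M) → Dist M B

IsRandOMM : (C : Matroid → Set) (B : Matroid) → RandFamily B → Set₁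
IsRandOMM C B D =
  (∀ M π → C M → IsOrdering M π → IsMorphDist M B (D M π))
  × (∀ M π m' → C M → IsOrdering M π → m' < length π →
       SameDist (prefixMatroid M π m') B (prefixOrdering M π m')
         (D (prefixMatroid M π m') (prefixOrdering M π m'))
         (restrictDist M B π m' (D M π)))

OrderIndependent : (C : Matroid → Set) (B : Matroid) → RandFamily B → Set₁
OrderIndependent C B D =
  ∀ M π π' → C M → IsOrdering M π → IsOrdering M π' → SameDist M B π (D M π) (D M π')

{-# OPTIONS --safe #-}
module Submission where

-- Compose f_{M,π} with an endomorphism t of BigM drawn uniformly at random.
-- Morphisms compose and restriction to a prefix commutes with composition,
-- so this is a randomized OMM.  If f_{M,π'} = A ∘ f_{M,π} for an automorphism
-- A, then t ↦ t ∘ A permutes the finitely many endomorphisms of BigM, so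
-- t ∘ f_{M,π'} = (t ∘ A) ∘ f_{M,π} has the same distribution as t ∘ f_{M,π}.

open import Defs
open import Data.Bool using (Bool; true; false)
open import Data.Bool.ListAction using (and)
open import Data.Empty using (⊥-elim)
open import Data.Fin using (Fin; zero; suc)
open import Data.Nat using (ℕ; zero; suc; _<_)
import Data.Nat.Properties as ℕ
open import Data.Rational using (ℚ; 0ℚ; 1ℚ; 1/_; Positive; NonZero)
  renaming (_+_ to _+ℚ_; _*_ to _*ℚ_; _≤_ to _≤ℚ_)
import Data.Rational.Properties as ℚ
open import Data.List as List
  using (List; []; _∷_; [_]; _++_; map; filter; length; deduplicate; cartesianProductWith)
import Data.List.Properties as List
open import Data.List.Membership.Propositional using (_∈_)
open import Data.List.Membership.Propositional.Properties
open import Data.List.Membership.Propositional.Properties.WithK using (unique∧set⇒bag)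
open import Data.List.Membership.DecPropositional as DecMembership using ()
open import Data.List.Relation.Unary.Any as Any using (here)
open import Data.List.Relation.Unary.Any.Properties using (lookup-index)
open import Data.List.Relation.Unary.All as All using (All)
import Data.List.Relation.Unary.All.Properties as All
open import Data.List.Relation.Unary.AllPairs using ([]; _∷_)
open import Data.List.Relation.Unary.Unique.Propositional using (Unique)
import Data.List.Relation.Unary.Unique.Propositional.Properties as Unique
import Data.List.Relation.Unary.Unique.DecPropositional.Properties as DecUnique
open import Data.List.Relation.Binary.Subset.Propositional.Properties using (map⁺)
open import Data.List.Relation.Binary.Permutation.Propositional using (_↭_; ↭⇒↭ₛ)
import Data.List.Relation.Binary.Permutation.Propositional.Properties as ↭
import Data.List.Relation.Binary.Permutation.Setoid.Properties as ↭ₛ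
open import Data.List.Relation.Binary.BagAndSetEquality using (∼bag⇒↭)
open import Data.Vec as Vec using (Vec; []; _∷_)
import Data.Vec.Properties as Vec
open import Data.Product using (Σ; _×_; _,_; proj₁; proj₂)
open import Function using (_∘_; id; mk⇔)
open import Relation.Binary.PropositionalEquality
  using (_≡_; _≗_; refl; sym; trans; cong; subst; setoid; module ≡-Reasoning)
open import Relation.Nullary using (Dec; does; ⌊_⌋)
open import Relation.Nullary.Decidable using (map′)
open import Relation.Unary using (Decidable)

lookup-injective : {X : Set} {xs : List X} → Unique xs →
                   ∀ {i j} → List.lookup xs i ≡ List.lookup xs j → i ≡ j
lookup-injective (_    ∷ _)   {zero}  {zero}  _  = refl
lookup-injective (x∉xs ∷ _)   {zero}  {suc j} eq = ⊥-elim (All.lookup x∉xs (∈-lookup j) eq)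
lookup-injective (x∉xs ∷ _)   {suc i} {zero}  eq = ⊥-elim (All.lookup x∉xs (∈-lookup i) (sym eq))
lookup-injective (_    ∷ xs!) {suc i} {suc j} eq = cong suc (lookup-injective xs! eq)

sublists : {X : Set} → List X → List (List X)
sublists []       = [ [] ]
sublists (x ∷ xs) = map (x ∷_) (sublists xs) ++ sublists xs

filter∈sublists : {X : Set} {P : X → Set} (P? : Decidable P) (xs : List X) →
                  filter P? xs ∈ sublists xs
filter∈sublists P? []       = here refl
filter∈sublists P? (x ∷ xs) with does (P? x)
... | true  = ∈-++⁺ˡ (∈-map⁺ (x ∷_) (filter∈sublists P? xs))
... | false = ∈-++⁺ʳ _ (filter∈sublists P? xs)

vectorsOver : {Y : Set} → List Y → (k : ℕ) → List (Vec Y k)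
vectorsOver ys zero    = [ [] ]
vectorsOver ys (suc k) = cartesianProductWith _∷_ ys (vectorsOver ys k)

vectorsOver-unique : {Y : Set} {ys : List Y} → Unique ys → ∀ k → Unique (vectorsOver ys k)
vectorsOver-unique ys! zero    = All.[] ∷ []
vectorsOver-unique ys! (suc k) =
  Unique.cartesianProductWith⁺ _∷_ Vec.∷-injective ys! (vectorsOver-unique ys! k)

∈-vectorsOver : {Y : Set} {ys : List Y} → (∀ y → y ∈ ys) →
                ∀ {k} (v : Vec Y k) → v ∈ vectorsOver ys k
∈-vectorsOver ∈ys []      = here refl
∈-vectorsOver ∈ys (y ∷ v) = ∈-cartesianProductWith⁺ _∷_ (∈ys y) (∈-vectorsOver ∈ys v)

-- Maps out of a type enumerated without repetition by xs are represented
-- by their tables of values along xs, so that pointwise equal maps have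
-- propositionally equal tables.
module Tabulation {X : Set} {xs : List X} (xs! : Unique xs) (∈xs : ∀ x → x ∈ xs) where

  Table : Set → Set
  Table Y = Vec Y (length xs)

  position : X → Fin (length xs)
  position x = Any.index (∈xs x)

  position-lookup : ∀ i → position (List.lookup xs i) ≡ i
  position-lookup i = lookup-injective xs! (sym (lookup-index (∈xs (List.lookup xs i))))

  app : {Y : Set} → Table Y → X → Y
  app t x = Vec.lookup t (position x)

  tabulate : {Y : Set} → (X → Y) → Table Y
  tabulate f = Vec.tabulate (f ∘ List.lookup xs)

  app-tabulate : {Y : Set} (f : X → Y) → app (tabulate f) ≗ f
  app-tabulate f x =
    trans (Vec.lookup∘tabulate _ (position x)) (cong f (sym (lookup-index (∈xs x))))

  app-injective : {Y : Set} {t u : Table Y} → app t ≗ app u → t ≡ u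
  app-injective {t = t} {u} t≗u = begin
    t                            ≡⟨ Vec.tabulate∘lookup t ⟨
    Vec.tabulate (Vec.lookup t)  ≡⟨ Vec.tabulate-cong lookup-t≗u ⟩
    Vec.tabulate (Vec.lookup u)  ≡⟨ Vec.tabulate∘lookup u ⟩
    u                            ∎
    where
    open ≡-Reasoning
    lookup-t≗u : Vec.lookup t ≗ Vec.lookup u
    lookup-t≗u i = subst (λ j → Vec.lookup t j ≡ Vec.lookup u j) (position-lookup i)
                         (t≗u (List.lookup xs i))

module _ {M : Matroid} (IM : IsMatroid M) where

  ground : List (E M)
  ground = proj₁ (IsMatroid.finite IM)

  ∈-ground : ∀ x → x ∈ ground
  ∈-ground = proj₂ (IsMatroid.finite IM)

  rank-resp-⊆⊇ : {S S′ : List (E M)} → S ⊆ₗ S′ → S′ ⊆ₗ S → rank M S ≡ rank M S′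
  rank-resp-⊆⊇ S⊆S′ S′⊆S =
    ℕ.≤-antisym (IsMatroid.rank-mono IM _ _ S⊆S′) (IsMatroid.rank-mono IM _ _ S′⊆S)

morphism-cong : (M N : Matroid) {a b : E M → E N} → a ≗ b → IsMorphism M N a → IsMorphism M N b
morphism-cong M N a≗b a-morphism S =
  trans (cong (rank N) (sym (List.map-cong a≗b S))) (a-morphism S)

morphism-∘ : (L M N : Matroid) {a : E M → E N} {b : E L → E M} →
             IsMorphism M N a → IsMorphism L M b → IsMorphism L N (a ∘ b)
morphism-∘ L M N {b = b} a-morphism b-morphism S =
  trans (cong (rank N) (List.map-∘ S)) (trans (a-morphism (map b S)) (b-morphism S))

id-morphism : (M : Matroid) → IsMorphism M M id
id-morphism M S = cong (rank M) (List.map-id S)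

-- The rank of a list only depends on its underlying subset of the finite
-- ground set, so being a morphism is a finite check.
isMorphism? : {M N : Matroid} → IsMatroid M → IsMatroid N → (a : E M → E N) → Dec (IsMorphism M N a)
isMorphism? {M} {N} IM IN a =
  map′ fromSublists (λ a-morphism → All.tabulate (λ {S} _ → a-morphism S))
       (All.all? (λ S → rank N (map a S) ℕ.≟ rank M S) (sublists (ground IM)))
  where
  fromSublists : All (λ S → rank N (map a S) ≡ rank M S) (sublists (ground IM)) → IsMorphism M N a
  fromSublists onSublists S = begin
    rank N (map a S)   ≡⟨ rank-resp-⊆⊇ IN (map⁺ a S⊆S′) (map⁺ a S′⊆S) ⟩
    rank N (map a S′)  ≡⟨ All.lookup onSublists (filter∈sublists ∈S? (ground IM)) ⟩
    rank M S′          ≡⟨ rank-resp-⊆⊇ IM S⊆S′ S′⊆S ⟨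
    rank M S           ∎
    where
    open ≡-Reasoning
    ∈S? = λ x → DecMembership._∈?_ (_≟_ M) x S
    S′ = filter ∈S? (ground IM)
    S⊆S′ : S ⊆ₗ S′
    S⊆S′ x∈S = ∈-filter⁺ ∈S? (∈-ground IM _) x∈S
    S′⊆S : S′ ⊆ₗ S
    S′⊆S x∈S′ = proj₂ (∈-filter⁻ ∈S? {xs = ground IM} x∈S′)

module Automorphism (B : Matroid) {A : E B → E B} (A-aut : IsAutomorphism B A) where

  A⁻¹ : E B → E B
  A⁻¹ y = proj₁ (proj₂ (proj₂ A-aut) y)

  A∘A⁻¹ : ∀ y → A (A⁻¹ y) ≡ y
  A∘A⁻¹ y = proj₂ (proj₂ (proj₂ A-aut) y) refl

  A⁻¹∘A : ∀ x → A⁻¹ (A x) ≡ x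
  A⁻¹∘A x = proj₁ (proj₂ A-aut) (A∘A⁻¹ (A x))

  A⁻¹-morphism : IsMorphism B B A⁻¹
  A⁻¹-morphism S = trans (sym (proj₁ A-aut (map A⁻¹ S)))
    (cong (rank B) (trans (sym (List.map-∘ S)) (trans (List.map-cong A∘A⁻¹ S) (List.map-id S))))

withWeight : {T X Y : Set} → ℚ → (T → X → Y) → List T → List (ℚ × (X → Y))
withWeight w F = map (λ t → w , F t)

agreeOn-cong : (M B : Matroid) (xs : List (E M)) {h h′ : E M → E B} (g : E M → E B) →
               h ≗ h′ → agreeOn M B xs h g ≡ agreeOn M B xs h′ g
agreeOn-cong M B xs g h≗h′ =
  cong and (List.map-cong (λ x → cong (λ y → ⌊ _≟_ B y (g x) ⌋) (h≗h′ x)) xs)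

mass-↭ : (M B : Matroid) (xs : List (E M)) (g : E M → E B) {D D′ : Dist M B} →
         D ↭ D′ → mass M B xs g D ≡ mass M B xs g D′
mass-↭ M B xs g D↭D′ = ↭ₛ.foldr-commMonoid (setoid ℚ) ℚ.+-0-isCommutativeMonoid
  (↭⇒↭ₛ (↭.map⁺ proj₁ (↭.filter-↭ _ D↭D′)))

mass-withWeight-cong : (M B : Matroid) (xs : List (E M)) (g : E M → E B) {T : Set} (w : ℚ)
                       {F G : T → E M → E B} → (∀ t → F t ≗ G t) → ∀ L →
                       mass M B xs g (withWeight w F L) ≡ mass M B xs g (withWeight w G L)
mass-withWeight-cong M B xs g w F≗G []      = refl
mass-withWeight-cong M B xs g w {F} {G} F≗G (t ∷ L)
  rewrite agreeOn-cong M B xs g (F≗G t) with agreeOn M B xs (G t) g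
... | true  = cong (w +ℚ_) (mass-withWeight-cong M B xs g w F≗G L)
... | false = mass-withWeight-cong M B xs g w F≗G L

fromℕ : ℕ → ℚ
fromℕ zero    = 0ℚ
fromℕ (suc n) = 1ℚ +ℚ fromℕ n

fromℕ-suc-positive : ∀ n → Positive (fromℕ (suc n))
fromℕ-suc-positive zero    = _
fromℕ-suc-positive (suc n) = ℚ.pos+pos⇒pos 1ℚ (fromℕ (suc n)) {{fromℕ-suc-positive n}}

fromℕ-suc-nonZero : ∀ n → NonZero (fromℕ (suc n))
fromℕ-suc-nonZero n = ℚ.pos⇒nonZero (fromℕ (suc n)) {{fromℕ-suc-positive n}}

totalWeight-withWeight : {T X Y : Set} (w : ℚ) (F : T → X → Y) (L : List T) →
                         sumℚ (map proj₁ (withWeight w F L)) ≡ fromℕ (length L) *ℚ w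
totalWeight-withWeight w F []      = sym (ℚ.*-zeroˡ w)
totalWeight-withWeight w F (t ∷ L) = begin
  w +ℚ sumℚ (map proj₁ (withWeight w F L))  ≡⟨ cong (w +ℚ_) (totalWeight-withWeight w F L) ⟩
  w +ℚ fromℕ (length L) *ℚ w                ≡⟨ cong (_+ℚ fromℕ (length L) *ℚ w) (ℚ.*-identityˡ w) ⟨
  1ℚ *ℚ w +ℚ fromℕ (length L) *ℚ w          ≡⟨ ℚ.*-distribʳ-+ w 1ℚ (fromℕ (length L)) ⟨
  fromℕ (suc (length L)) *ℚ w               ∎
  where open ≡-Reasoning

uniformWeight : ℕ → ℚ
uniformWeight zero    = 0ℚ
uniformWeight (suc n) = (1/ fromℕ (suc n)) {{fromℕ-suc-nonZero n}}

uniformWeight-nonNegative : ∀ n → 0ℚ ≤ℚ uniformWeight n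
uniformWeight-nonNegative zero    = ℚ.≤-refl
uniformWeight-nonNegative (suc n) = ℚ.<⇒≤ (ℚ.positive⁻¹ (uniformWeight (suc n))
  {{ℚ.1/pos⇒pos (fromℕ (suc n)) {{fromℕ-suc-positive n}}}})

uniform : {T X Y : Set} → (T → X → Y) → List T → List (ℚ × (X → Y))
uniform F L = withWeight (uniformWeight (length L)) F L

uniform-isMorphDist : (M B : Matroid) {T : Set} {F : T → E M → E B} {L : List T} {t : T} →
                      t ∈ L → (∀ {t} → t ∈ L → IsMorphism M B (F t)) → IsMorphDist M B (uniform F L)
uniform-isMorphDist M B {F = F} {L = L@(_ ∷ L′)} _ F-morphism =
  All.map⁺ (All.tabulate λ _ → uniformWeight-nonNegative (length L)) ,
  trans (totalWeight-withWeight _ F L)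
        (ℚ.*-inverseʳ (fromℕ (length L)) {{fromℕ-suc-nonZero (length L′)}}) ,
  All.map⁺ (All.tabulate F-morphism)

module Endomorphisms (B : Matroid) (IB : IsMatroid B) where

  elements : List (E B)
  elements = deduplicate (_≟_ B) (ground IB)

  elements-unique : Unique elements
  elements-unique = DecUnique.deduplicate-! (_≟_ B) (ground IB)

  ∈-elements : ∀ x → x ∈ elements
  ∈-elements x = ∈-deduplicate⁺ (_≟_ B) (∈-ground IB x)

  open Tabulation elements-unique ∈-elements public

  End : List (Table (E B))
  End = filter (isMorphism? IB IB ∘ app) (vectorsOver elements (length elements))

  End-unique : Unique End
  End-unique = Unique.filter⁺ (isMorphism? IB IB ∘ app) (vectorsOver-unique elements-unique _)

  ∈-End⁻ : ∀ {t} → t ∈ End → IsMorphism B B (app t)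
  ∈-End⁻ t∈End = proj₂ (∈-filter⁻ (isMorphism? IB IB ∘ app) {xs = vectorsOver elements _} t∈End)

  tabulate∈End : ∀ {a} → IsMorphism B B a → tabulate a ∈ End
  tabulate∈End {a} a-morphism = ∈-filter⁺ (isMorphism? IB IB ∘ app) (∈-vectorsOver ∈-elements _)
                                          (morphism-cong B B (sym ∘ app-tabulate a) a-morphism)

  precompose : (E B → E B) → Table (E B) → Table (E B)
  precompose A t = tabulate (app t ∘ A)

  precompose-↭ : ∀ {A} → IsAutomorphism B A → map (precompose A) End ↭ End
  precompose-↭ {A} A-aut = ∼bag⇒↭ (unique∧set⇒bag
    (Unique.map⁺ precompose-injective End-unique) End-unique (mk⇔ image⊆End End⊆image))
    where
    open Automorphism B A-aut

    precompose-injective : ∀ {t u} → precompose A t ≡ precompose A u → t ≡ u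
    precompose-injective {t} {u} eq = app-injective λ y → begin
      app t y                       ≡⟨ cong (app t) (A∘A⁻¹ y) ⟨
      app t (A (A⁻¹ y))             ≡⟨ app-tabulate (app t ∘ A) (A⁻¹ y) ⟨
      app (precompose A t) (A⁻¹ y)  ≡⟨ cong (λ v → app v (A⁻¹ y)) eq ⟩
      app (precompose A u) (A⁻¹ y)  ≡⟨ app-tabulate (app u ∘ A) (A⁻¹ y) ⟩
      app u (A (A⁻¹ y))             ≡⟨ cong (app u) (A∘A⁻¹ y) ⟩
      app u y                       ∎
      where open ≡-Reasoning

    image⊆End : ∀ {s} → s ∈ map (precompose A) End → s ∈ End
    image⊆End s∈image with ∈-map⁻ (precompose A) s∈image
    ... | t , t∈End , refl = tabulate∈End (morphism-∘ B B B (∈-End⁻ t∈End) (proj₁ A-aut))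

    End⊆image : ∀ {s} → s ∈ End → s ∈ map (precompose A) End
    End⊆image {s} s∈End = subst (_∈ map (precompose A) End) precompose-undone
      (∈-map⁺ (precompose A) (tabulate∈End (morphism-∘ B B B (∈-End⁻ s∈End) A⁻¹-morphism)))
      where
      precompose-undone : precompose A (tabulate (app s ∘ A⁻¹)) ≡ s
      precompose-undone = app-injective λ x →
        trans (app-tabulate _ x) (trans (app-tabulate (app s ∘ A⁻¹) (A x)) (cong (app s) (A⁻¹∘A x)))

  uniformEnd∘ : {X : Set} → (X → E B) → List (ℚ × (X → E B))
  uniformEnd∘ h = uniform (λ t → app t ∘ h) End

  uniformEnd∘-isMorphDist : (M : Matroid) {h : E M → E B} →
                            IsMorphism M B h → IsMorphDist M B (uniformEnd∘ h)
  uniformEnd∘-isMorphDist M h-morphism = uniform-isMorphDist M B (tabulate∈End (id-morphism B))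
    (λ t∈End → morphism-∘ M B B (∈-End⁻ t∈End) h-morphism)

  uniformEnd∘-cong : (M : Matroid) (xs : List (E M)) {h h′ : E M → E B} →
                     h ≗ h′ → SameDist M B xs (uniformEnd∘ h) (uniformEnd∘ h′)
  uniformEnd∘-cong M xs h≗h′ g = mass-withWeight-cong M B xs g _ (λ t → cong (app t) ∘ h≗h′) End

  uniformEnd∘-∘ : {X Y : Set} (h : X → E B) (r : Y → X) →
                           map (λ wh → proj₁ wh , proj₂ wh ∘ r) (uniformEnd∘ h) ≡ uniformEnd∘ (h ∘ r)
  uniformEnd∘-∘ h r = sym (List.map-∘ End)

  uniformEnd∘-invariant : (M : Matroid) (xs : List (E M)) {h : E M → E B} {A : E B → E B} →
                          IsAutomorphism B A → SameDist M B xs (uniformEnd∘ (A ∘ h)) (uniformEnd∘ h)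
  uniformEnd∘-invariant M xs {h} {A} A-aut g = begin
    mass M B xs g (withWeight w (λ t → app t ∘ A ∘ h) End)
      ≡⟨ mass-withWeight-cong M B xs g w (λ t → sym ∘ app-tabulate (app t ∘ A) ∘ h) End ⟩
    mass M B xs g (withWeight w (λ t → app (precompose A t) ∘ h) End)
      ≡⟨ cong (mass M B xs g) (List.map-∘ End) ⟩
    mass M B xs g (withWeight w (λ t → app t ∘ h) (map (precompose A) End))
      ≡⟨ mass-↭ M B xs g (↭.map⁺ _ (precompose-↭ A-aut)) ⟩
    mass M B xs g (withWeight w (λ t → app t ∘ h) End)
      ∎
    where
    open ≡-Reasoning
    w = uniformWeight (length End)

theorem3 : (C : Matroid → Set) (B : Matroid)
    → (∀ M → C M → IsMatroid M)
    → (∀ M (S : E M → Bool) → C M → C (restrict M S))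
    → IsMatroid B
    → (f : Family B) → IsOMM C B f
    → (∀ M π π' → C M → IsOrdering M π → IsOrdering M π'
         → Σ (E B → E B) (λ A → IsAutomorphism B A × (∀ x → f M π' x ≡ A (f M π x))))
    → Σ (RandFamily B) (λ D → IsRandOMM C B D × OrderIndependent C B D)
theorem3 C B _ _ IB f (f-morphism , f-online) f-equivariant =
  D , (D-morphDist , D-online) , D-orderIndependent
  where
  open Endomorphisms B IB

  D : RandFamily B
  D M π = uniformEnd∘ (f M π)

  D-morphDist : ∀ M π → C M → IsOrdering M π → IsMorphDist M B (D M π)
  D-morphDist M π CM π-ordering = uniformEnd∘-isMorphDist M (f-morphism M π CM π-ordering)

  D-online : ∀ M π m′ → C M → IsOrdering M π → m′ < length π →
             let M′ = prefixMatroid M π m′; π′ = prefixOrdering M π m′ in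
             SameDist M′ B π′ (D M′ π′) (restrictDist M B π m′ (D M π))
  D-online M π m′ CM π-ordering m′<m g =
    trans (uniformEnd∘-cong M′ π′ (f-online M π m′ CM π-ordering m′<m) g)
          (cong (mass M′ B π′ g) (sym (uniformEnd∘-∘ (f M π) proj₁)))
    where
    M′ = prefixMatroid M π m′
    π′ = prefixOrdering M π m′

  D-orderIndependent : OrderIndependent C B D
  D-orderIndependent M π π′ CM π-ordering π′-ordering g
    with A , A-aut , f-π′≡A∘f-π ← f-equivariant M π π′ CM π-ordering π′-ordering =
    sym (trans (uniformEnd∘-cong M π f-π′≡A∘f-π g) (uniformEnd∘-invariant M π A-aut g))
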